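{- Let $K$ be a finite complete graph whose edges are colored by elements of a finite set $\Gamma$, and let $S$ be the set of integers $n\geq 2$ such that $K$ contains no colorful $n$-cycle. If $4\in S$, then there is an odd integer $m\geq 3$ such that $S$ consists exactly of all even integers $2,4,\dots,m-1$ together with all integers $k\geq m$, i.e., $S=\{2,4,6,\dots,m-1,m,m+1,m+2,\dots\}$.
   Context: An $n$-cycle ($n\geq 2$) is a sequence $(v_1,\dots,v_n)$ of distinct vertices, with edges $v_iv_{i+1}$, indices mod $n$. A cycle in an edge-colored graph is colorful if its edges have pairwise distinct colors. -}

module Defs where

open import Data.Nat using (ℕ; zero; suc; _<_; _≤_; _%_)
open import Data.Nat.DivMod using (m%n<n)
open import Data.Fin using (Fin; toℕ; fromℕ<)
open import Data.Product using (Σ; _×_)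
open import Function.Definitions using (Injective)
open import Relation.Binary.PropositionalEquality using (_≡_)

next : ∀ {n} → Fin n → Fin n
next {suc n} i = fromℕ< (m%n<n (suc (toℕ i)) (suc n))

-- The colour of edge {x,y} (x ≠ y)
-- is c x y; the values on the diagonal are irrelevant.
record EdgeColouring (N g : ℕ) : Set where
  field
    colour : Fin N → Fin N → Fin g
    symmetric : ∀ x y → colour x y ≡ colour y x

-- An n-cycle (v₁,…,vₙ): n pairwise distinct vertices; in a complete graph
-- all consecutive pairs v_i v_{i+1} (indices mod n) are edges.
IsColourfulCycle : ∀ {N g} → EdgeColouring N g → (n : ℕ) → (Fin n → Fin N) → Set
IsColourfulCycle K n v =
  Injective _≡_ _≡_ v ×
  Injective _≡_ _≡_ (λ i → EdgeColouring.colour K (v i) (v (next i)))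

HasColourfulCycle : ∀ {N g} → EdgeColouring N g → ℕ → Set
HasColourfulCycle {N} K n = Σ (Fin n → Fin N) (IsColourfulCycle K n)

-- Dropping v_{n+2} and v_{n+3} from a colourful (n + 4)-cycle v₀ … v_{n+3} and
-- closing up with the chord v_{n+1} v₀ gives a colourful (n + 2)-cycle: if the
-- chord colour repeated that of a kept edge, it would differ from the colours of
-- the three dropped edges, and the 4-cycle v₀ v_{n+1} v_{n+2} v_{n+3} would be
-- colourful.  So, without colourful 4-cycles, the lengths without colourful
-- cycles are closed under n ↦ n + 2 from n = 2 upwards.  There are no colourful
-- 2-cycles, hence no even ones; the odd lengths ≥ 3 without colourful cycles are
-- exactly those beyond the least one, which exists since no cycle is longer than
-- the number of vertices.
module Submission where

open import Defs
open import Data.Nat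
  using (ℕ; zero; suc; _+_; _*_; _%_; _<_; _≤_; z≤n; s≤s; _≤′_; ≤′-refl; ≤′-step; _<?_)
open import Data.Nat.Properties
  using (≤⇒≤′; ≰⇒>; ≮⇒≥; ≤-trans; +-comm; m≤n+m; m≤m*n; +-monoʳ-≤; *-monoˡ-≤; +-cancelˡ-≤; *-cancelʳ-≤)
open import Data.Nat.DivMod using (m<n⇒m%n≡m; n%n≡0)
open import Data.Nat.Divisibility using (_∣_; ∣⇒≤; ∣m+n∣m⇒∣n; n∣m*n)
open import Data.Fin.Base as Fin using (Fin; zero; suc; toℕ; fromℕ; inject₁; finToFun; funToFin)
open import Data.Fin.Properties
  using (toℕ-injective; toℕ-fromℕ<; toℕ-fromℕ; toℕ-inject₁; toℕ<n; inject₁-injective; <⇒≢; <-trans; _≟_;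
         any?; all?; pigeonhole; finToFun-funToFin)
open import Data.Fin.Relation.Unary.Top using (view; ‵fromℕ; ‵inject₁)
open import Data.Vec.Base using (Vec; []; _∷_; lookup)
open import Data.Vec.Relation.Unary.All using ([]; _∷_)
open import Data.Vec.Relation.Unary.AllPairs using ([]; _∷_)
open import Data.Vec.Relation.Unary.Unique.Propositional using (Unique)
open import Data.Vec.Relation.Unary.Unique.Propositional.Properties using (map⁺; lookup-injective)
open import Data.Product using (Σ; _×_; ∃; ∃-syntax; _,_)
open import Data.Sum using (_⊎_; inj₁; inj₂; [_,_])
open import Data.Empty using (⊥-elim)
open import Function.Base using (_∘_; id)
open import Function.Bundles using (_⇔_; mk⇔; Equivalence)
open import Function.Definitions using (Injective)
open import Relation.Nullary using (¬_; Dec; yes; no; contradiction)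
open import Relation.Nullary.Decidable using (map′; ¬?; _×-dec_; _→-dec_)
open import Relation.Binary.PropositionalEquality
  using (_≡_; _≢_; _≗_; refl; sym; trans; cong; cong₂; subst; module ≡-Reasoning)

inject₁<fromℕ : ∀ {n} (i : Fin n) → inject₁ i Fin.< fromℕ n
inject₁<fromℕ zero    = s≤s z≤n
inject₁<fromℕ (suc i) = s≤s (inject₁<fromℕ i)

inject₁-mono-< : ∀ {n} {i j : Fin n} → i Fin.< j → inject₁ i Fin.< inject₁ j
inject₁-mono-< {i = zero}  {suc j} _         = s≤s z≤n
inject₁-mono-< {i = suc i} {suc j} (s≤s i<j) = s≤s (inject₁-mono-< i<j)

next-inject₁ : ∀ {n} (i : Fin n) → next (inject₁ i) ≡ suc i
next-inject₁ {n} i = toℕ-injective (begin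
  toℕ (next (inject₁ i))            ≡⟨ toℕ-fromℕ< _ ⟩
  suc (toℕ (inject₁ i)) % suc n     ≡⟨ cong (λ k → suc k % suc n) (toℕ-inject₁ i) ⟩
  suc (toℕ i) % suc n               ≡⟨ m<n⇒m%n≡m (s≤s (toℕ<n i)) ⟩
  suc (toℕ i)                       ∎)
  where open ≡-Reasoning

next-fromℕ : ∀ n → next (fromℕ n) ≡ zero
next-fromℕ n = toℕ-injective (begin
  toℕ (next (fromℕ n))           ≡⟨ toℕ-fromℕ< _ ⟩
  suc (toℕ (fromℕ n)) % suc n    ≡⟨ cong (λ k → suc k % suc n) (toℕ-fromℕ n) ⟩
  suc n % suc n                  ≡⟨ n%n≡0 (suc n) ⟩
  0                              ∎)
  where open ≡-Reasoning

injective-resp-≗ : ∀ {A B : Set} {f g : A → B} →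
  f ≗ g → Injective _≡_ _≡_ f → Injective _≡_ _≡_ g
injective-resp-≗ f≗g f-inj {x} {y} gx≡gy = f-inj (trans (f≗g x) (trans gx≡gy (sym (f≗g y))))

unique⇒lookup-injective : ∀ {A : Set} {n} {xs : Vec A n} → Unique xs → Injective _≡_ _≡_ (lookup xs)
unique⇒lookup-injective xs-unique {i} {j} = lookup-injective xs-unique i j

injective? : ∀ {m n} (f : Fin m → Fin n) → Dec (Injective _≡_ _≡_ f)
injective? f = map′ (λ inj {i} {j} → inj i j) (λ inj i j → inj)
  (all? λ i → all? λ j → (f i ≟ f j) →-dec (i ≟ j))

-- Every function Fin m → Fin n is pointwise a finToFun k, so it suffices to search Fin (n ^ m).
∃-fun? : ∀ {m n} {Q : (Fin m → Fin n) → Set} →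
  (∀ {f g} → f ≗ g → Q f → Q g) → (∀ f → Dec (Q f)) → Dec (∃ Q)
∃-fun? Q-resp Q? = map′ (λ (k , Qk) → finToFun k , Qk)
  (λ (f , Qf) → funToFin f , Q-resp (sym ∘ finToFun-funToFin f) Qf)
  (any? (Q? ∘ finToFun))

data EvenOdd : ℕ → Set where
  even : ∀ k → EvenOdd (k * 2)
  odd  : ∀ k → EvenOdd (1 + k * 2)

evenOdd : ∀ n → EvenOdd n
evenOdd zero = even 0
evenOdd (suc n) with evenOdd n
... | even k = odd k
... | odd k  = even (suc k)

odd-∤ : ∀ k → ¬ (2 ∣ 1 + k * 2)
odd-∤ k 2∣odd = contradiction (∣⇒≤ (∣m+n∣m⇒∣n (subst (2 ∣_) (+-comm 1 (k * 2)) 2∣odd) (n∣m*n k)))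
  λ { (s≤s ()) }

module UpwardClosed {Q : ℕ → Set} (Q-suc : ∀ {i} → Q i → Q (suc i)) where

  monotone : ∀ {i j} → i ≤ j → Q i → Q j
  monotone = monotone′ ∘ ≤⇒≤′
    where
    monotone′ : ∀ {i j} → i ≤′ j → Q i → Q j
    monotone′ ≤′-refl        = id
    monotone′ (≤′-step i≤′j) = Q-suc ∘ monotone′ i≤′j

  threshold : (∀ i → Dec (Q i)) → ∀ {k} → Q k → ∃[ j ] (∀ i → Q i ⇔ j ≤ i)
  threshold Q? {zero} Q0 = 0 , λ i → mk⇔ (λ _ → z≤n) (λ _ → monotone z≤n Q0)
  threshold Q? {suc k} Qk+1 with Q? k
  ... | yes Qk = threshold Q? Qk
  ... | no ¬Qk = suc k , λ i →
    mk⇔ (λ Qi → ≰⇒> (λ i≤k → ¬Qk (monotone i≤k Qi))) (λ k<i → monotone k<i Qk+1)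

-- In Fin (4 + n), a, b, c are the positions n + 1, n + 2, n + 3, and ι embeds Fin (2 + n)
-- as the positions 0, …, n + 1.
module DroppedPositions (n : ℕ) where

  ι : Fin (2 + n) → Fin (4 + n)
  ι = inject₁ ∘ inject₁

  ι-injective : Injective _≡_ _≡_ ι
  ι-injective = inject₁-injective ∘ inject₁-injective

  a : Fin (4 + n)
  a = ι (fromℕ (suc n))
  b : Fin (4 + n)
  b = inject₁ (fromℕ (2 + n))
  c : Fin (4 + n)
  c = fromℕ (3 + n)

  a<b : a Fin.< b
  a<b = inject₁-mono-< (inject₁<fromℕ (fromℕ (suc n)))
  b<c : b Fin.< c
  b<c = inject₁<fromℕ (fromℕ (2 + n))

  inner<a : ∀ j → ι (inject₁ j) Fin.< a
  inner<a j = inject₁-mono-< (inject₁-mono-< (inject₁<fromℕ j))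
  inner<b : ∀ j → ι (inject₁ j) Fin.< b
  inner<b j = <-trans (inner<a j) a<b
  inner<c : ∀ j → ι (inject₁ j) Fin.< c
  inner<c j = <-trans (inner<b j) b<c

  abc-unique : Unique (a ∷ b ∷ c ∷ [])
  abc-unique = (<⇒≢ a<b ∷ <⇒≢ (<-trans a<b b<c) ∷ []) ∷ (<⇒≢ b<c ∷ []) ∷ [] ∷ []

  zabc-unique : Unique (zero ∷ a ∷ b ∷ c ∷ [])
  zabc-unique = (<⇒≢ (s≤s z≤n) ∷ <⇒≢ (s≤s z≤n) ∷ <⇒≢ (s≤s z≤n) ∷ []) ∷ abc-unique

  next-a : next a ≡ b
  next-a = next-inject₁ _
  next-b : next b ≡ c
  next-b = next-inject₁ _
  next-c : next c ≡ zero
  next-c = next-fromℕ _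

  next-ι-inner : ∀ j → next (ι (inject₁ j)) ≡ ι (next (inject₁ j))
  next-ι-inner j = trans (next-inject₁ _) (cong ι (sym (next-inject₁ j)))

  ι-next-last : ι (next (fromℕ (suc n))) ≡ zero
  ι-next-last = cong ι (next-fromℕ (suc n))

module _ {N g : ℕ} (K : EdgeColouring N g) where
  open EdgeColouring K

  isColourfulCycle-resp : ∀ {n} {v v′ : Fin n → Fin N} →
    v ≗ v′ → IsColourfulCycle K n v → IsColourfulCycle K n v′
  isColourfulCycle-resp v≗v′ (v-inj , edge-inj) =
    injective-resp-≗ v≗v′ v-inj ,
    injective-resp-≗ (λ i → cong₂ colour (v≗v′ i) (v≗v′ (next i))) edge-inj

  hasColourfulCycle? : ∀ n → Dec (HasColourfulCycle K n)
  hasColourfulCycle? n = ∃-fun? isColourfulCycle-resp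
    λ v → injective? v ×-dec injective? (λ i → colour (v i) (v (next i)))

  no-colourful-2-cycle : ¬ HasColourfulCycle K 2
  no-colourful-2-cycle (v , _ , edge-inj)
    with edge-inj {zero} {suc zero} (symmetric (v zero) (v (suc zero)))
  ... | ()

  no-long-colourful-cycle : ∀ {n} → N < n → ¬ HasColourfulCycle K n
  no-long-colourful-cycle N<n (v , v-inj , _) with pigeonhole N<n v
  ... | i , j , i<j , vi≡vj = <⇒≢ i<j (v-inj vi≡vj)

  shortcut : ¬ HasColourfulCycle K 4 → ∀ n → HasColourfulCycle K (4 + n) → HasColourfulCycle K (2 + n)
  shortcut no4 n (w , w-inj , edge-inj) = w ∘ ι , ι-injective ∘ w-inj , short-edge-inj
    where
    open DroppedPositions n

    edge : Fin (4 + n) → Fin g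
    edge i = colour (w i) (w (next i))

    chord : Fin g
    chord = colour (w zero) (w a)

    quad : Fin 4 → Fin N
    quad = lookup (w zero ∷ w a ∷ w b ∷ w c ∷ [])

    quad-unique : Unique (w zero ∷ w a ∷ w b ∷ w c ∷ [])
    quad-unique = map⁺ w-inj zabc-unique

    quad-edges : (λ i → colour (quad i) (quad (next i)))
               ≗ lookup (chord ∷ edge a ∷ edge b ∷ edge c ∷ [])
    quad-edges zero                   = refl
    quad-edges (suc zero)             = cong (colour (w a) ∘ w) (sym next-a)
    quad-edges (suc (suc zero))       = cong (colour (w b) ∘ w) (sym next-b)
    quad-edges (suc (suc (suc zero))) = cong (colour (w c) ∘ w) (sym next-c)

    chord-unrepeated : ∀ j → chord ≢ edge (ι (inject₁ j))
    chord-unrepeated j chord≡ = no4 (quad , unique⇒lookup-injective quad-unique ,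
      injective-resp-≗ (sym ∘ quad-edges) (unique⇒lookup-injective quad-edges-unique))
      where
      apart : ∀ {r} → ι (inject₁ j) Fin.< r → chord ≢ edge r
      apart inner<r chord≡edge = <⇒≢ inner<r (edge-inj (trans (sym chord≡) chord≡edge))

      quad-edges-unique : Unique (chord ∷ edge a ∷ edge b ∷ edge c ∷ [])
      quad-edges-unique =
        (apart (inner<a j) ∷ apart (inner<b j) ∷ apart (inner<c j) ∷ []) ∷ map⁺ edge-inj abc-unique

    short-edge : Fin (2 + n) → Fin g
    short-edge i = colour (w (ι i)) (w (ι (next i)))

    short-edge-inner : ∀ j → short-edge (inject₁ j) ≡ edge (ι (inject₁ j))
    short-edge-inner j = cong (colour (w (ι (inject₁ j))) ∘ w) (sym (next-ι-inner j))

    short-edge-last : short-edge (fromℕ (suc n)) ≡ chord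
    short-edge-last = trans (cong (colour (w a) ∘ w) ι-next-last) (symmetric (w a) (w zero))

    short-edge-inj : Injective _≡_ _≡_ short-edge
    short-edge-inj {i} {j} e with view i | view j
    ... | ‵fromℕ     | ‵fromℕ     = refl
    ... | ‵inject₁ i′ | ‵inject₁ j′ =
      ι-injective (edge-inj (trans (sym (short-edge-inner i′)) (trans e (short-edge-inner j′))))
    ... | ‵inject₁ i′ | ‵fromℕ     =
      ⊥-elim (chord-unrepeated i′ (trans (sym short-edge-last) (trans (sym e) (short-edge-inner i′))))
    ... | ‵fromℕ     | ‵inject₁ j′ =
      ⊥-elim (chord-unrepeated j′ (trans (sym short-edge-last) (trans e (short-edge-inner j′))))

module _ {N g : ℕ} (K : EdgeColouring N g) (no4 : ¬ HasColourfulCycle K 4) where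

  no-even-colourful-cycle : ∀ k → ¬ HasColourfulCycle K (2 + k * 2)
  no-even-colourful-cycle zero    = no-colourful-2-cycle K
  no-even-colourful-cycle (suc k) = no-even-colourful-cycle k ∘ shortcut K no4 (k * 2)

  odd-threshold : ∃[ j ] (∀ i → (¬ HasColourfulCycle K (3 + i * 2)) ⇔ j ≤ i)
  odd-threshold = UpwardClosed.threshold (λ {i} ¬cycle → ¬cycle ∘ shortcut K no4 (1 + i * 2))
    (λ i → ¬? (hasColourfulCycle? K (3 + i * 2))) {N}
    (no-long-colourful-cycle K (s≤s (≤-trans (m≤m*n N 2) (m≤n+m (N * 2) 2))))

  colourful-cycle-spectrum : ∀ {j} → (∀ i → (¬ HasColourfulCycle K (3 + i * 2)) ⇔ j ≤ i) →
    ∀ n → 2 ≤ n → (¬ HasColourfulCycle K n) ⇔ ((2 ∣ n × n < 3 + j * 2) ⊎ 3 + j * 2 ≤ n)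
  colourful-cycle-spectrum {j} odd-iff n 2≤n with evenOdd n
  colourful-cycle-spectrum {j} odd-iff _ () | even zero
  colourful-cycle-spectrum {j} odd-iff _ (s≤s ()) | odd zero
  ... | even (suc k) = mk⇔ (λ _ → below-or-above) (λ _ → no-even-colourful-cycle k)
    where
    below-or-above : (2 ∣ suc k * 2 × suc k * 2 < 3 + j * 2) ⊎ 3 + j * 2 ≤ suc k * 2
    below-or-above with suc k * 2 <? 3 + j * 2
    ... | yes below = inj₁ (n∣m*n (suc k) , below)
    ... | no ¬below = inj₂ (≮⇒≥ ¬below)
  ... | odd (suc i) = mk⇔
    (λ ¬cycle → inj₂ (+-monoʳ-≤ 3 (*-monoˡ-≤ 2 (Equivalence.to (odd-iff i) ¬cycle))))
    [ (λ (2∣n , _) → ⊥-elim (odd-∤ (suc i) 2∣n))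
    , (λ m≤n → Equivalence.from (odd-iff i) (*-cancelʳ-≤ j i 2 (+-cancelˡ-≤ 3 (j * 2) (i * 2) m≤n))) ]

mainTheorem3 : ∀ {N g : ℕ} (K : EdgeColouring N g) →
    ¬ HasColourfulCycle K 4 →
    Σ ℕ (λ m → ¬ (2 ∣ m) × 3 ≤ m ×
      (∀ n → 2 ≤ n → ((¬ HasColourfulCycle K n) ⇔ ((2 ∣ n × n < m) ⊎ m ≤ n))))
mainTheorem3 K no4 with odd-threshold K no4
... | j , odd-iff =
  3 + j * 2 , odd-∤ (suc j) , s≤s (s≤s (s≤s z≤n)) , colourful-cycle-spectrum K no4 odd-iff
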